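{- Let $2\le p<q$ be coprime integers. Let $y_{p_0},y_{q_0}$ be nonnegative integers and let $a_0$ be a nonnegative integer with $a_0<p^{y_{p_0}}q^{y_{q_0}}$. Let $\ell\ge1$ and let $d_1,\dots,d_\ell$, $m_1,\dots,m_\ell$ be integers and $M_1,\dots,M_\ell$ positive integers. Then the following two statements are equivalent: (1) each $d_i$ is divisible by $\gcd(p-1,q-1)$; (2) there exist integers $t_1,\dots,t_\ell$, integers $y_p>y_{p_0}$, $y_q>y_{q_0}$, and an integer $a$ such that $t_i\equiv m_i\pmod{M_i}$ for all $1\le i\le\ell$, $a\equiv a_0\pmod{p^{y_{p_0}}q^{y_{q_0}}}$, and for every nonnegative integer $n\equiv a\pmod{p^{y_p}q^{y_q}}$ and every $1\le i\le\ell$ with $n+t_i\ge0$, $$s_p(n+t_i)-s_q(n+t_i)=s_p(n)-s_q(n)+d_i.$$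
   Context: For an integer $b\ge2$ and a nonnegative integer $n=\sum_{j\ge0}a_jb^j$ with digits $a_j\in\{0,\dots,b-1\}$, $s_b(n)=\sum_j a_j$. -}

module Defs where

open import Data.Nat using (ℕ; zero; suc; NonZero; _≤_)
open import Data.Nat.DivMod using (_/_; _%_)
open import Data.Nat.Base as ℕ using ()
open import Data.Integer using (ℤ; +_; _-_)
open import Data.Integer.Divisibility using (_∣_)

-- base-b digit expansion summed, by fuel; with fuel ≥ number of digits it is exact.
-- Since n / b < n for n ≥ 1 and b ≥ 2, fuel n suffices.
digitSumFuel : ℕ → (b : ℕ) → .{{NonZero b}} → ℕ → ℕ
digitSumFuel zero    b n = 0
digitSumFuel (suc k) b n = n % b ℕ.+ digitSumFuel k b (n / b)

s : (b : ℕ) → .{{NonZero b}} → ℕ → ℕ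
s b n = digitSumFuel n b n

_≡_[mod_] : ℤ → ℤ → ℕ → Set
x ≡ y [mod M ] = (+ M) ∣ (x - y)

module Submission where

-- Since s_b(x) ≡ x (mod b - 1), the difference s_p(x) - s_q(x) is always divisible by
-- g = gcd(p - 1, q - 1); this gives (2) ⇒ (1).
-- For (1) ⇒ (2) the conditions are met one at a time, each step refining the residue class
-- a (mod p^y q^y') produced by the previous one. Take t ≡ m (mod M) with t ≥ p^y, q^y'.
-- In base b ∈ {p, q} pick a residue r of the form (J digits b - 1)·b^L + R, where
-- R ≡ a (mod b^y) and R + t = b^L + σ with σ < b^L.
-- For every n ≡ r (mod b^(L+J+1)) adding t carries exactly through those J digits, so
-- s_b(n + t) - s_b(n) = s_b(R + t) - s_b(R) - (b - 1)J does not depend on n. As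
-- s_b(R + t) - s_b(R) ≡ t (mod b - 1), the J and J' making the p- and q-increments differ by d
-- exist by Bézout exactly when g ∣ d, and the CRT glues the residues for p and q.

open import Defs
open import Data.Nat as ℕ using (ℕ; zero; suc; _≤_; _<_; _∸_; _^_; NonZero; z≤n; s≤s)
import Data.Nat.Properties as ℕ
open import Data.Nat.Induction using (<-rec)
open import Data.Nat.DivMod using (_%_; _/_; %-remove-+ʳ; m≡m%n+[m/n]*n; m<n⇒m%n≡m; m<n⇒m/n≡0; 0/n≡0; m/n<m; [m+kn]%n≡m%n; +-distrib-/-∣ʳ; m*n/n≡m; m<n*o⇒m/o<n; m%n<n)
import Data.Nat.Divisibility as ℕ
open import Data.Nat.Coprimality as Coprime using (Coprime; coprime⇒gcd≡1; coprime-Bézout; coprime-divisor)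
open import Data.Nat.GCD using (gcd; gcd-GCD; gcd[m,n]∣m; gcd[m,n]∣n; module Bézout)
open import Data.Nat.LCM using (lcm; lcm-least; gcd*lcm)
open import Data.Integer as ℤ using (ℤ; +_; -[1+_]; _+_; _-_; _*_; -_; ∣_∣)
import Data.Integer.Properties as ℤ
open import Data.Integer.DivMod using (_%ℕ_; _/ℕ_; a≡a%ℕn+[a/ℕn]*n; n%ℕd<d)
open import Data.Integer.Divisibility using (_∣_)
open import Data.Integer.Divisibility.Signed as Signed using (divides; ∣ᵤ⇒∣; ∣⇒∣ᵤ)
open import Data.Fin using (Fin; zero; suc)
open import Data.Product using (Σ; ∃; ∃₂; _×_; _,_; proj₁; proj₂)
open import Data.Sum using (inj₁; inj₂)
open import Function using (_∘_)
open import Function.Bundles using (_⇔_; mk⇔)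
open import Relation.Binary.PropositionalEquality hiding (J)
open import Data.Integer.Tactic.RingSolver using (solve-∀)
open import Data.Nat.Tactic.RingSolver using () renaming (solve-∀ to ℕ-solve-∀)

-- Congruences modulo a natural number

module _ {K : ℕ} where

  private
    signed : ∀ x y → x ≡ y [mod K ] → + K Signed.∣ (x - y)
    signed x y = ∣ᵤ⇒∣ {i = x - y}

    unsigned : ∀ x y {w} → w ≡ x - y → + K Signed.∣ w → x ≡ y [mod K ]
    unsigned x y refl = ∣⇒∣ᵤ

  ≡[mod]-intro : ∀ x y z → x - y ≡ + K * z → x ≡ y [mod K ]
  ≡[mod]-intro x y z e = unsigned x y refl (divides z (trans e (ℤ.*-comm (+ K) z)))

  ≡[mod]-refl : ∀ x → x ≡ x [mod K ]
  ≡[mod]-refl x = ≡[mod]-intro x x (+ 0) (lemma x (+ K))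
    where lemma : ∀ x k → x - x ≡ k * + 0
          lemma = solve-∀

  ≡[mod]-trans : ∀ x y z → x ≡ y [mod K ] → y ≡ z [mod K ] → x ≡ z [mod K ]
  ≡[mod]-trans x y z x≡y y≡z = unsigned x z (lemma x y z) (Signed.∣m∣n⇒∣m+n (signed x y x≡y) (signed y z y≡z))
    where lemma : ∀ x y z → (x - y) + (y - z) ≡ x - z
          lemma = solve-∀

∣a-c∧∣b-c⇒∣a-b : ∀ {k} a b c → k Signed.∣ a - c → k Signed.∣ b - c → k Signed.∣ a - b
∣a-c∧∣b-c⇒∣a-b a b c k∣a-c k∣b-c = subst (Signed._∣_ _) (lemma a b c) (Signed.∣m∣n⇒∣m-n k∣a-c k∣b-c)
  where lemma : ∀ a b c → (a - c) - (b - c) ≡ a - b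
        lemma = solve-∀

^-∣ : ∀ b {i j} → i ≤ j → b ^ i ℕ.∣ b ^ j
^-∣ b {i} {j} i≤j = ℕ.divides (b ^ (j ∸ i)) (begin
  b ^ j                  ≡⟨ cong (b ^_) (ℕ.m+[n∸m]≡n i≤j) ⟨
  b ^ (i ℕ.+ (j ∸ i))    ≡⟨ ℕ.^-distribˡ-+-* b i (j ∸ i) ⟩
  b ^ i ℕ.* b ^ (j ∸ i)  ≡⟨ ℕ.*-comm (b ^ i) _ ⟩
  b ^ (j ∸ i) ℕ.* b ^ i  ∎)
  where open ≡-Reasoning

coprime⇒*∣ : ∀ {K L n} → Coprime K L → K ℕ.∣ n → L ℕ.∣ n → K ℕ.* L ℕ.∣ n
coprime⇒*∣ {K} {L} K⊥L K∣n L∣n = subst (ℕ._∣ _) lcm≡* (lcm-least K∣n L∣n)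
  where
  lcm≡* : lcm K L ≡ K ℕ.* L
  lcm≡* = trans (sym (ℕ.*-identityˡ (lcm K L))) (trans (cong (ℕ._* lcm K L) (sym (coprime⇒gcd≡1 K⊥L))) (gcd*lcm K L))

∣∸⇒%≡% : ∀ {i j K} .{{_ : NonZero K}} → i ≤ j → K ℕ.∣ j ∸ i → j % K ≡ i % K
∣∸⇒%≡% {i} {K = K} i≤j K∣j-i = trans (cong (_% K) (sym (ℕ.m+[n∸m]≡n i≤j))) (%-remove-+ʳ i K∣j-i)

≡[mod]⇒%≡% : ∀ {m n K} .{{_ : NonZero K}} → (+ m) ≡ (+ n) [mod K ] → m % K ≡ n % K
≡[mod]⇒%≡% {m} {n} {K} K∣m-n with ℕ.≤-total m n | cong ∣_∣ (ℤ.[+m]-[+n]≡m⊖n m n)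
... | inj₁ m≤n | ∣m-n∣ = sym (∣∸⇒%≡% m≤n (subst (K ℕ.∣_) (trans ∣m-n∣ (ℤ.∣⊖∣-≤ m≤n)) K∣m-n))
... | inj₂ n≤m | ∣m-n∣ =
  ∣∸⇒%≡% n≤m (subst (K ℕ.∣_) (trans ∣m-n∣ (trans (ℤ.∣m⊖n∣≡∣n⊖m∣ m n) (ℤ.∣⊖∣-≤ n≤m))) K∣m-n)

%ℕ+*≡[mod] : ∀ (a : ℤ) K k .{{_ : NonZero K}} → (+ (a %ℕ K ℕ.+ K ℕ.* k)) ≡ a [mod K ]
%ℕ+*≡[mod] a K k = ≡[mod]-intro (+ (a %ℕ K ℕ.+ K ℕ.* k)) a (+ k - a /ℕ K) (begin
  + (a %ℕ K ℕ.+ K ℕ.* k) - a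
    ≡⟨ cong₂ _-_ (trans (ℤ.pos-+ (a %ℕ K) (K ℕ.* k)) (cong (_+_ (+ (a %ℕ K))) (ℤ.pos-* K k))) (a≡a%ℕn+[a/ℕn]*n a K) ⟩
  (+ (a %ℕ K) + + K * + k) - (+ (a %ℕ K) + a /ℕ K * + K)
    ≡⟨ lemma (+ (a %ℕ K)) (+ K) (+ k) (a /ℕ K) ⟩
  + K * (+ k - a /ℕ K) ∎)
  where
  open ≡-Reasoning
  lemma : ∀ r K k q → (r + K * k) - (r + q * K) ≡ K * (k - q)
  lemma = solve-∀

pos-+-* : ∀ d y n x m → d ℕ.+ y ℕ.* n ≡ x ℕ.* m → + d + + y * + n ≡ + x * + m
pos-+-* d y n x m e = trans (cong (_+_ (+ d)) (sym (ℤ.pos-* y n))) (trans (cong +_ e) (ℤ.pos-* x m))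

m≡n+k⇒+m-+n≡+k : ∀ {m n k} → m ≡ n ℕ.+ k → + m - + n ≡ + k
m≡n+k⇒+m-+n≡+k {m} {n} {k} refl = lemma (+ n) (+ k)
  where lemma : ∀ n k → (n + k) - n ≡ k
        lemma = solve-∀

a+[b+c]≡d+e⇒a-d≡e-b-c : ∀ a b c d e → a ℕ.+ (b ℕ.+ c) ≡ d ℕ.+ e → + a - + d ≡ (+ e - + b) - + c
a+[b+c]≡d+e⇒a-d≡e-b-c a b c d e eq = begin
  + a - + d                                    ≡⟨ lemma₁ (+ a) (+ b) (+ c) (+ d) ⟩
  (+ a + (+ b + + c)) - + d - + b - + c        ≡⟨ cong (λ w → w - + d - + b - + c) (cong +_ eq) ⟩
  (+ d + + e) - + d - + b - + c                ≡⟨ lemma₂ (+ b) (+ c) (+ d) (+ e) ⟩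
  (+ e - + b) - + c                            ∎
  where
  open ≡-Reasoning
  lemma₁ : ∀ a b c d → a - d ≡ (a + (b + c)) - d - b - c
  lemma₁ = solve-∀
  lemma₂ : ∀ b c d e → (d + e) - d - b - c ≡ (e - b) - c
  lemma₂ = solve-∀

∣i∣≤n⇒0≤n+i : ∀ {n} i → ∣ i ∣ ≤ n → + 0 ℤ.≤ + n + i
∣i∣≤n⇒0≤n+i (+ _)      _     = ℤ.+≤+ z≤n
∣i∣≤n⇒0≤n+i -[1+ _ ] 1+i≤n = subst (+ 0 ℤ.≤_) (sym (ℤ.⊖-≥ 1+i≤n)) (ℤ.+≤+ z≤n)

-- Bézout's identity and its consequences

coprime-*ʳ : ∀ {m n k} → Coprime m n → Coprime m k → Coprime m (n ℕ.* k)
coprime-*ʳ {n = n} m⊥n m⊥k {i} (i∣m , i∣nk) = m⊥k (i∣m , coprime-divisor i⊥n i∣nk)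
  where
  i⊥n : Coprime i n
  i⊥n (j∣i , j∣n) = m⊥n (ℕ.∣-trans j∣i i∣m , j∣n)

coprime-^ʳ : ∀ {m n} k → Coprime m n → Coprime m (n ^ k)
coprime-^ʳ zero    m⊥n (_ , i∣1) = ℕ.∣1⇒≡1 i∣1
coprime-^ʳ (suc k) m⊥n = coprime-*ʳ m⊥n (coprime-^ʳ k m⊥n)

coprime-^ : ∀ {m n} i j → Coprime m n → Coprime (m ^ i) (n ^ j)
coprime-^ i j m⊥n = Coprime.sym (coprime-^ʳ i (Coprime.sym (coprime-^ʳ j m⊥n)))

bézout-ℤ : ∀ {d m n} → Bézout.Identity d m n → ∃₂ λ u v → u * + m + v * + n ≡ + d
bézout-ℤ {d} {m} {n} (Bézout.+- x y d+yn≡xm) = + x , - + y , (begin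
  + x * + m + - + y * + n          ≡⟨ cong (_+ - + y * + n) (sym (pos-+-* d y n x m d+yn≡xm)) ⟩
  (+ d + + y * + n) + - + y * + n  ≡⟨ lemma (+ d) (+ y) (+ n) ⟩
  + d                              ∎)
  where
  open ≡-Reasoning
  lemma : ∀ d y n → (d + y * n) + - y * n ≡ d
  lemma = solve-∀
bézout-ℤ {d} {m} {n} (Bézout.-+ x y d+xm≡yn) = - + x , + y , (begin
  - + x * + m + + y * + n          ≡⟨ cong (_+_ (- + x * + m)) (sym (pos-+-* d x m y n d+xm≡yn)) ⟩
  - + x * + m + (+ d + + x * + m)  ≡⟨ lemma (+ d) (+ x) (+ m) ⟩
  + d                              ∎)
  where
  open ≡-Reasoning
  lemma : ∀ d x m → - x * m + (d + x * m) ≡ d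
  lemma = solve-∀

crt : ∀ {P Q} → Coprime P Q → ∀ x y → ∃ λ a → a ≡ x [mod P ] × a ≡ y [mod Q ]
crt {P} {Q} P⊥Q x y with bézout-ℤ (coprime-Bézout P⊥Q)
... | u , v , uP+vQ≡1 = a , ≡[mod]-intro a x (u * (y - x)) a-x , ≡[mod]-intro a y (v * (x - y)) a-y
  where
  a = x * (v * + Q) + y * (u * + P)
  open ≡-Reasoning
  times-uP+vQ : ∀ z → z ≡ z * (u * + P + v * + Q)
  times-uP+vQ z = trans (sym (ℤ.*-identityʳ z)) (cong (z *_) (sym uP+vQ≡1))
  a-x : a - x ≡ + P * (u * (y - x))
  a-x = begin
    a - x                        ≡⟨ cong (_-_ a) (times-uP+vQ x) ⟩
    a - x * (u * + P + v * + Q)  ≡⟨ lemma x y u v (+ P) (+ Q) ⟩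
    + P * (u * (y - x))          ∎
    where lemma : ∀ x y u v P Q → (x * (v * Q) + y * (u * P)) - x * (u * P + v * Q) ≡ P * (u * (y - x))
          lemma = solve-∀
  a-y : a - y ≡ + Q * (v * (x - y))
  a-y = begin
    a - y                        ≡⟨ cong (_-_ a) (times-uP+vQ y) ⟩
    a - y * (u * + P + v * + Q)  ≡⟨ lemma x y u v (+ P) (+ Q) ⟩
    + Q * (v * (x - y))          ∎
    where lemma : ∀ x y u v P Q → (x * (v * Q) + y * (u * P)) - y * (u * P + v * Q) ≡ Q * (v * (x - y))
          lemma = solve-∀

bézout⇒v*J'≡u*J+c*g : ∀ {g u v} → Bézout.Identity g u v → 1 ≤ u → 1 ≤ v →
                       ∀ c → ∃₂ λ J J' → v ℕ.* J' ≡ u ℕ.* J ℕ.+ c ℕ.* g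
bézout⇒v*J'≡u*J+c*g {g} {u} {v} (Bézout.-+ x y g+xu≡yv) _ _ c = c ℕ.* x , c ℕ.* y , (begin
  v ℕ.* (c ℕ.* y)           ≡⟨ lemma₁ v c y ⟩
  c ℕ.* (y ℕ.* v)           ≡⟨ cong (c ℕ.*_) g+xu≡yv ⟨
  c ℕ.* (g ℕ.+ x ℕ.* u)     ≡⟨ lemma₂ c g x u ⟩
  u ℕ.* (c ℕ.* x) ℕ.+ c ℕ.* g ∎)
  where
  open ≡-Reasoning
  lemma₁ : ∀ v c y → v ℕ.* (c ℕ.* y) ≡ c ℕ.* (y ℕ.* v)
  lemma₁ = ℕ-solve-∀
  lemma₂ : ∀ c g x u → c ℕ.* (g ℕ.+ x ℕ.* u) ≡ u ℕ.* (c ℕ.* x) ℕ.+ c ℕ.* g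
  lemma₂ = ℕ-solve-∀
bézout⇒v*J'≡u*J+c*g {g} {suc u'} {suc v'} (Bézout.+- x y g+yv≡xu) _ _ c = J , J' , ℕ.+-cancelʳ-≡ (c ℕ.* (y ℕ.* v)) _ _ (begin
  v ℕ.* J' ℕ.+ c ℕ.* (y ℕ.* v)           ≡⟨ lemma₁ u' v' c x y ⟩
  u ℕ.* J ℕ.+ c ℕ.* (x ℕ.* u)            ≡⟨ cong (λ z → u ℕ.* J ℕ.+ c ℕ.* z) g+yv≡xu ⟨
  u ℕ.* J ℕ.+ c ℕ.* (g ℕ.+ y ℕ.* v)      ≡⟨ lemma₂ (u ℕ.* J) c g (y ℕ.* v) ⟩
  u ℕ.* J ℕ.+ c ℕ.* g ℕ.+ c ℕ.* (y ℕ.* v) ∎)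
  where
  open ≡-Reasoning
  u = suc u'
  v = suc v'
  -- the solution (- c x , - c y) of v J' = u J + c (x u - y v), shifted by c (x + y) (v , u)
  J = v ℕ.* c ℕ.* y ℕ.+ v' ℕ.* c ℕ.* x
  J' = u ℕ.* c ℕ.* x ℕ.+ u' ℕ.* c ℕ.* y
  lemma₁ : ∀ u' v' c x y → suc v' ℕ.* (suc u' ℕ.* c ℕ.* x ℕ.+ u' ℕ.* c ℕ.* y) ℕ.+ c ℕ.* (y ℕ.* suc v')
                         ≡ suc u' ℕ.* (suc v' ℕ.* c ℕ.* y ℕ.+ v' ℕ.* c ℕ.* x) ℕ.+ c ℕ.* (x ℕ.* suc u')
  lemma₁ = ℕ-solve-∀
  lemma₂ : ∀ a c g b → a ℕ.+ c ℕ.* (g ℕ.+ b) ≡ a ℕ.+ c ℕ.* g ℕ.+ c ℕ.* b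
  lemma₂ = ℕ-solve-∀

gcd∣⇒v*J'-u*J≡ : ∀ {u v} → 1 ≤ u → 1 ≤ v → ∀ D → (+ gcd u v) Signed.∣ D →
                 ∃₂ λ J J' → + (v ℕ.* J') - + (u ℕ.* J) ≡ D
gcd∣⇒v*J'-u*J≡ {u} {v} 1≤u 1≤v D (divides (+ c) refl)
  with J , J' , e ← bézout⇒v*J'≡u*J+c*g (Bézout.identity (gcd-GCD u v)) 1≤u 1≤v c
  = J , J' , trans (m≡n+k⇒+m-+n≡+k {n = u ℕ.* J} e) (ℤ.pos-* c (gcd u v))
gcd∣⇒v*J'-u*J≡ {u} {v} 1≤u 1≤v D (divides -[1+ c ] refl)
  with J' , J , e ← bézout⇒v*J'≡u*J+c*g (Bézout.Identity.sym (Bézout.identity (gcd-GCD u v))) 1≤v 1≤u (suc c)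
  = J , J' , (begin
    + (v ℕ.* J') - + (u ℕ.* J)    ≡⟨ lemma (+ (u ℕ.* J)) (+ (v ℕ.* J')) ⟩
    - (+ (u ℕ.* J) - + (v ℕ.* J')) ≡⟨ cong -_ (trans (m≡n+k⇒+m-+n≡+k {n = v ℕ.* J'} e) (ℤ.pos-* (suc c) (gcd u v))) ⟩
    - (+ suc c * + gcd u v)        ≡⟨ ℤ.neg-distribˡ-* (+ suc c) (+ gcd u v) ⟩
    -[1+ c ] * + gcd u v           ∎)
  where
  open ≡-Reasoning
  lemma : ∀ a b → b - a ≡ - (a - b)
  lemma = solve-∀

-- Digit sums

module DigitSum (b : ℕ) .{{_ : NonZero b}} (2≤b : 2 ≤ b) where

  private
    0<b : 0 < b
    0<b = ℕ.≤-trans (s≤s z≤n) 2≤b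

    0%b≡0 : 0 % b ≡ 0
    0%b≡0 = m<n⇒m%n≡m 0<b

    /b-≤ : ∀ {n k} → n ≤ suc k → n / b ≤ k
    /b-≤ {zero}  _         = ℕ.≤-trans (ℕ.≤-reflexive (0/n≡0 b)) z≤n
    /b-≤ {suc n} (s≤s n≤k) = ℕ.≤-trans (ℕ.≤-pred (m/n<m (suc n) b 2≤b)) n≤k

    digitSumFuel-0 : ∀ k → digitSumFuel k b 0 ≡ 0
    digitSumFuel-0 zero    = refl
    digitSumFuel-0 (suc k) = trans (cong₂ ℕ._+_ 0%b≡0 (cong (digitSumFuel k b) (0/n≡0 b))) (digitSumFuel-0 k)

    digitSumFuel-enough : ∀ k j {n} → n ≤ k → n ≤ j → digitSumFuel k b n ≡ digitSumFuel j b n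
    digitSumFuel-enough zero    j       z≤n _   = sym (digitSumFuel-0 j)
    digitSumFuel-enough (suc k) zero    _   z≤n = digitSumFuel-0 (suc k)
    digitSumFuel-enough (suc k) (suc j) {n} n≤k n≤j =
      cong (n % b ℕ.+_) (digitSumFuel-enough k j (/b-≤ n≤k) (/b-≤ n≤j))

  s-step : ∀ n → s b n ≡ n % b ℕ.+ s b (n / b)
  s-step zero    = sym (cong₂ ℕ._+_ 0%b≡0 (cong (s b) (0/n≡0 b)))
  s-step (suc n) = cong (suc n % b ℕ.+_) (digitSumFuel-enough n (suc n / b) (/b-≤ ℕ.≤-refl) ℕ.≤-refl)

  s-digit : ∀ {r} h → r < b → s b (r ℕ.+ h ℕ.* b) ≡ r ℕ.+ s b h
  s-digit {r} h r<b = begin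
    s b (r ℕ.+ h ℕ.* b)                                        ≡⟨ s-step _ ⟩
    (r ℕ.+ h ℕ.* b) % b ℕ.+ s b ((r ℕ.+ h ℕ.* b) / b)          ≡⟨ cong₂ (λ x y → x ℕ.+ s b y) last-digit rest ⟩
    r ℕ.+ s b h                                                ∎
    where
    open ≡-Reasoning
    last-digit : (r ℕ.+ h ℕ.* b) % b ≡ r
    last-digit = trans ([m+kn]%n≡m%n r h b) (m<n⇒m%n≡m r<b)
    rest : (r ℕ.+ h ℕ.* b) / b ≡ h
    rest = trans (+-distrib-/-∣ʳ r (ℕ.n∣m*n h)) (cong₂ ℕ._+_ (m<n⇒m/n≡0 r<b) (m*n/n≡m h b))

  s-+-^* : ∀ k {x} h → x < b ^ k → s b (x ℕ.+ b ^ k ℕ.* h) ≡ s b x ℕ.+ s b h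
  s-+-^* zero    {zero}  h _         = cong (s b) (ℕ.*-identityˡ h)
  s-+-^* zero    {suc _} h (s≤s ())
  s-+-^* (suc k) {x}    h x<b^k+1 = begin
    s b (x ℕ.+ b ^ suc k ℕ.* h)                        ≡⟨ cong (s b) split ⟩
    s b (x % b ℕ.+ (x / b ℕ.+ b ^ k ℕ.* h) ℕ.* b)      ≡⟨ s-digit (x / b ℕ.+ b ^ k ℕ.* h) (m%n<n x b) ⟩
    x % b ℕ.+ s b (x / b ℕ.+ b ^ k ℕ.* h)              ≡⟨ cong (x % b ℕ.+_) (s-+-^* k h x/b<b^k) ⟩
    x % b ℕ.+ (s b (x / b) ℕ.+ s b h)                  ≡⟨ ℕ.+-assoc (x % b) _ _ ⟨
    x % b ℕ.+ s b (x / b) ℕ.+ s b h                    ≡⟨ cong (ℕ._+ s b h) (s-step x) ⟨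
    s b x ℕ.+ s b h                                    ∎
    where
    open ≡-Reasoning
    x/b<b^k : x / b < b ^ k
    x/b<b^k = m<n*o⇒m/o<n (subst (x <_) (ℕ.*-comm b (b ^ k)) x<b^k+1)
    split : x ℕ.+ b ^ suc k ℕ.* h ≡ x % b ℕ.+ (x / b ℕ.+ b ^ k ℕ.* h) ℕ.* b
    split = trans (cong (ℕ._+ b ^ suc k ℕ.* h) (m≡m%n+[m/n]*n x b)) (lemma (x % b) (x / b) b (b ^ k) h)
      where lemma : ∀ r q b c h → r ℕ.+ q ℕ.* b ℕ.+ b ℕ.* c ℕ.* h ≡ r ℕ.+ (q ℕ.+ c ℕ.* h) ℕ.* b
            lemma = ℕ-solve-∀

  s-^* : ∀ k h → s b (b ^ k ℕ.* h) ≡ s b h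
  s-^* k h = s-+-^* k h (ℕ.m^n>0 b k)

  s-1 : s b 1 ≡ 1
  s-1 = s-digit 0 2≤b

  s-^ : ∀ k → s b (b ^ k) ≡ 1
  s-^ k = trans (cong (s b) (sym (ℕ.*-identityʳ (b ^ k)))) (trans (s-^* k 1) s-1)

  maxDigits : ℕ → ℕ
  maxDigits zero    = 0
  maxDigits (suc J) = (b ∸ 1) ℕ.+ maxDigits J ℕ.* b

  suc-maxDigits : ∀ J → suc (maxDigits J) ≡ b ^ J
  suc-maxDigits zero    = refl
  suc-maxDigits (suc J) = begin
    suc (b ∸ 1) ℕ.+ maxDigits J ℕ.* b  ≡⟨ cong (ℕ._+ maxDigits J ℕ.* b) (ℕ.suc-pred b) ⟩
    suc (maxDigits J) ℕ.* b            ≡⟨ cong (ℕ._* b) (suc-maxDigits J) ⟩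
    b ^ J ℕ.* b                        ≡⟨ ℕ.*-comm (b ^ J) b ⟩
    b ^ suc J                          ∎
    where open ≡-Reasoning

  s-maxDigits : ∀ J → s b (maxDigits J) ≡ (b ∸ 1) ℕ.* J
  s-maxDigits zero    = sym (ℕ.*-zeroʳ (b ∸ 1))
  s-maxDigits (suc J) = begin
    s b (b ∸ 1 ℕ.+ maxDigits J ℕ.* b)  ≡⟨ s-digit (maxDigits J) (ℕ.≤-reflexive (ℕ.suc-pred b)) ⟩
    b ∸ 1 ℕ.+ s b (maxDigits J)        ≡⟨ cong ((b ∸ 1) ℕ.+_) (s-maxDigits J) ⟩
    b ∸ 1 ℕ.+ (b ∸ 1) ℕ.* J            ≡⟨ ℕ.*-suc (b ∸ 1) J ⟨
    (b ∸ 1) ℕ.* suc J                  ∎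
    where open ≡-Reasoning

  s-excess : ∀ n → ∃ λ k → n ≡ s b n ℕ.+ (b ∸ 1) ℕ.* k
  s-excess = <-rec _ excess
    where
    excess : ∀ n → (∀ {m} → m < n → ∃ λ k → m ≡ s b m ℕ.+ (b ∸ 1) ℕ.* k) →
             ∃ λ k → n ≡ s b n ℕ.+ (b ∸ 1) ℕ.* k
    excess zero    _   = 0 , sym (ℕ.*-zeroʳ (b ∸ 1))
    excess n@(suc _) rec with k , n/b≡ ← rec (m/n<m n b 2≤b) = s b (n / b) ℕ.+ k ℕ.* b , (begin
      n                                              ≡⟨ m≡m%n+[m/n]*n n b ⟩
      n % b ℕ.+ n / b ℕ.* b                          ≡⟨ cong (λ z → n % b ℕ.+ z ℕ.* b) n/b≡ ⟩
      n % b ℕ.+ (s b (n / b) ℕ.+ c ℕ.* k) ℕ.* b      ≡⟨ cong (λ z → n % b ℕ.+ (s b (n / b) ℕ.+ c ℕ.* k) ℕ.* z) b≡1+c ⟩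
      n % b ℕ.+ (s b (n / b) ℕ.+ c ℕ.* k) ℕ.* suc c  ≡⟨ lemma (n % b) (s b (n / b)) k c ⟩
      n % b ℕ.+ s b (n / b) ℕ.+ c ℕ.* (s b (n / b) ℕ.+ k ℕ.* suc c)
                                                     ≡⟨ cong₂ (λ x y → x ℕ.+ c ℕ.* (s b (n / b) ℕ.+ k ℕ.* y)) (s-step n) b≡1+c ⟨
      s b n ℕ.+ c ℕ.* (s b (n / b) ℕ.+ k ℕ.* b)      ∎)
      where
      open ≡-Reasoning
      c = b ∸ 1
      b≡1+c : b ≡ suc c
      b≡1+c = sym (ℕ.suc-pred b)
      lemma : ∀ r s k c → r ℕ.+ (s ℕ.+ c ℕ.* k) ℕ.* suc c ≡ r ℕ.+ s ℕ.+ c ℕ.* (s ℕ.+ k ℕ.* suc c)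
      lemma = ℕ-solve-∀

  ∣s-n : ∀ {k} → k ℕ.∣ b ∸ 1 → ∀ n → + k Signed.∣ + s b n - + n
  ∣s-n k∣b-1 n with e , n≡s+ce ← s-excess n =
    Signed.∣-trans (∣ᵤ⇒∣ k∣b-1) (divides (- + e) (begin
      + s b n - + n             ≡⟨ lemma (+ s b n) (+ n) ⟩
      - (+ n - + s b n)         ≡⟨ cong -_ (trans (m≡n+k⇒+m-+n≡+k n≡s+ce) (cong +_ (ℕ.*-comm (b ∸ 1) e))) ⟩
      - + (e ℕ.* (b ∸ 1))       ≡⟨ cong -_ (ℤ.pos-* e (b ∸ 1)) ⟩
      - (+ e * + (b ∸ 1))       ≡⟨ ℤ.neg-distribˡ-* (+ e) (+ (b ∸ 1)) ⟩
      - + e * + (b ∸ 1)         ∎))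
    where
    open ≡-Reasoning
    lemma : ∀ a b → a - b ≡ - (b - a)
    lemma = solve-∀

  s-carry-free : ∀ {E r t n} → r ℕ.+ t < b ^ E → (+ n) ≡ (+ r) [mod b ^ E ] →
            s b (n ℕ.+ t) ℕ.+ s b r ≡ s b n ℕ.+ s b (r ℕ.+ t)
  s-carry-free {E} {r} {t} {n} r+t<b^E n≡r = begin
    s b (n ℕ.+ t) ℕ.+ s b r                      ≡⟨ cong (λ m → s b (m ℕ.+ t) ℕ.+ s b r) n≡r+b^E*h ⟩
    s b (r ℕ.+ b ^ E ℕ.* h ℕ.+ t) ℕ.+ s b r      ≡⟨ cong (λ m → s b m ℕ.+ s b r) (lemma r (b ^ E ℕ.* h) t) ⟩
    s b (r ℕ.+ t ℕ.+ b ^ E ℕ.* h) ℕ.+ s b r      ≡⟨ cong (ℕ._+ s b r) (s-+-^* E h r+t<b^E) ⟩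
    s b (r ℕ.+ t) ℕ.+ s b h ℕ.+ s b r            ≡⟨ swap (s b r) (s b h) (s b (r ℕ.+ t)) ⟨
    s b r ℕ.+ s b h ℕ.+ s b (r ℕ.+ t)            ≡⟨ cong (ℕ._+ s b (r ℕ.+ t)) (s-+-^* E h r<b^E) ⟨
    s b (r ℕ.+ b ^ E ℕ.* h) ℕ.+ s b (r ℕ.+ t)    ≡⟨ cong (λ m → s b m ℕ.+ s b (r ℕ.+ t)) n≡r+b^E*h ⟨
    s b n ℕ.+ s b (r ℕ.+ t)                      ∎
    where
    open ≡-Reasoning
    instance
      b^E≢0 : NonZero (b ^ E)
      b^E≢0 = ℕ.m^n≢0 b E
    h = n / b ^ E
    r<b^E : r < b ^ E
    r<b^E = ℕ.≤-<-trans (ℕ.m≤m+n r t) r+t<b^E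
    n≡r+b^E*h : n ≡ r ℕ.+ b ^ E ℕ.* h
    n≡r+b^E*h = begin
      n                          ≡⟨ m≡m%n+[m/n]*n n (b ^ E) ⟩
      n % b ^ E ℕ.+ h ℕ.* b ^ E  ≡⟨ cong₂ ℕ._+_ (trans (≡[mod]⇒%≡% n≡r) (m<n⇒m%n≡m r<b^E)) (ℕ.*-comm h (b ^ E)) ⟩
      r ℕ.+ b ^ E ℕ.* h          ∎
    lemma : ∀ x y z → x ℕ.+ y ℕ.+ z ≡ x ℕ.+ z ℕ.+ y
    lemma = ℕ-solve-∀
    swap : ∀ x y z → x ℕ.+ y ℕ.+ z ≡ z ℕ.+ y ℕ.+ x
    swap = ℕ-solve-∀

  n<b^n : ∀ n → n < b ^ n
  n<b^n zero    = s≤s z≤n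
  n<b^n (suc n) = ℕ.≤-<-trans (n<b^n n) (ℕ.^-monoʳ-< b 2≤b (ℕ.n<1+n n))

  Δs : ℕ → ℕ → ℤ
  Δs t m = + s b (m ℕ.+ t) - + s b m

  ∣Δs-t : ∀ {k} → k ℕ.∣ b ∸ 1 → ∀ t m → + k Signed.∣ Δs t m - + t
  ∣Δs-t k∣b-1 t m = subst (Signed._∣_ _) (lemma (+ s b (m ℕ.+ t)) (+ s b m) (+ m) (+ t))
    (Signed.∣m∣n⇒∣m-n (∣s-n k∣b-1 (m ℕ.+ t)) (∣s-n k∣b-1 m))
    where lemma : ∀ x y m t → (x - (m + t)) - (y - m) ≡ (x - y) - t
          lemma = solve-∀

  -- Adding t to R carries exactly one unit into position L.
  module ShiftResidue (Y0 : ℕ) (a : ℤ) {t : ℕ} (b^Y0≤t : b ^ Y0 ≤ t) where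

    private instance
      b^Y0≢0 : NonZero (b ^ Y0)
      b^Y0≢0 = ℕ.m^n≢0 b Y0

    L : ℕ
    L = Y0 ℕ.+ t

    σ : ℕ
    σ = (a + + t) %ℕ b ^ Y0

    R : ℕ
    R = b ^ L ℕ.+ σ ∸ t

    σ<t : σ < t
    σ<t = ℕ.<-≤-trans (n%ℕd<d (a + + t) (b ^ Y0)) b^Y0≤t

    t<b^L : t < b ^ L
    t<b^L = ℕ.<-≤-trans (n<b^n t) (ℕ.^-monoʳ-≤ b (ℕ.m≤n+m t Y0))

    σ<b^L : σ < b ^ L
    σ<b^L = ℕ.<-trans σ<t t<b^L

    R+t≡σ+b^L : R ℕ.+ t ≡ σ ℕ.+ b ^ L
    R+t≡σ+b^L = trans (ℕ.m∸n+n≡m (ℕ.≤-trans (ℕ.<⇒≤ t<b^L) (ℕ.m≤m+n (b ^ L) σ))) (ℕ.+-comm (b ^ L) σ)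

    R<b^L : R < b ^ L
    R<b^L = ℕ.+-cancelʳ-< t R (b ^ L) (begin-strict
      R ℕ.+ t      ≡⟨ R+t≡σ+b^L ⟩
      σ ℕ.+ b ^ L  <⟨ ℕ.+-monoˡ-< (b ^ L) σ<t ⟩
      t ℕ.+ b ^ L  ≡⟨ ℕ.+-comm t (b ^ L) ⟩
      b ^ L ℕ.+ t  ∎)
      where open ℕ.≤-Reasoning

    R≡a : (+ R) ≡ a [mod b ^ Y0 ]
    R≡a = ≡[mod]-intro (+ R) a (+ b ^ t - q) (begin
      + R - a                                          ≡⟨ lemma₁ (+ R) a (+ t) ⟩
      (+ R + + t) - (a + + t)                          ≡⟨ cong₂ _-_ R+t≡ (a≡a%ℕn+[a/ℕn]*n (a + + t) (b ^ Y0)) ⟩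
      (+ σ + + b ^ Y0 * + b ^ t) - (+ σ + q * + b ^ Y0) ≡⟨ lemma₂ (+ σ) (+ b ^ Y0) (+ b ^ t) q ⟩
      + b ^ Y0 * (+ b ^ t - q)                         ∎)
      where
      open ≡-Reasoning
      q = (a + + t) /ℕ b ^ Y0
      R+t≡ : + R + + t ≡ + σ + + b ^ Y0 * + b ^ t
      R+t≡ = trans (cong +_ R+t≡σ+b^L) (cong (_+_ (+ σ)) (trans (cong +_ (ℕ.^-distribˡ-+-* b Y0 t)) (ℤ.pos-* (b ^ Y0) (b ^ t))))
      lemma₁ : ∀ R a t → R - a ≡ (R + t) - (a + t)
      lemma₁ = solve-∀
      lemma₂ : ∀ σ K c q → (σ + K * c) - (σ + q * K) ≡ K * (c - q)
      lemma₂ = solve-∀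

    s[σ+b^L*b^J] : ∀ J → s b (σ ℕ.+ b ^ L ℕ.* b ^ J) ≡ s b σ ℕ.+ 1
    s[σ+b^L*b^J] J = trans (s-+-^* L (b ^ J) σ<b^L) (cong (s b σ ℕ.+_) (s-^ J))

    module WithMaxDigits (J : ℕ) where

      E : ℕ
      E = suc (L ℕ.+ J)

      r : ℕ
      r = R ℕ.+ b ^ L ℕ.* maxDigits J

      Y0<E : Y0 < E
      Y0<E = s≤s (ℕ.≤-trans (ℕ.m≤m+n Y0 t) (ℕ.m≤m+n L J))

      r≡a : (+ r) ≡ a [mod b ^ Y0 ]
      r≡a = ≡[mod]-trans (+ r) (+ R) a (≡[mod]-intro (+ r) (+ R) (+ (b ^ t ℕ.* maxDigits J)) r-R) R≡a
        where
        b^L*m≡b^Y0*[b^t*m] : b ^ L ℕ.* maxDigits J ≡ b ^ Y0 ℕ.* (b ^ t ℕ.* maxDigits J)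
        b^L*m≡b^Y0*[b^t*m] =
          trans (cong (ℕ._* maxDigits J) (ℕ.^-distribˡ-+-* b Y0 t)) (ℕ.*-assoc (b ^ Y0) (b ^ t) (maxDigits J))
        r-R : + r - + R ≡ + b ^ Y0 * + (b ^ t ℕ.* maxDigits J)
        r-R = trans (m≡n+k⇒+m-+n≡+k {n = R} refl) (trans (cong +_ b^L*m≡b^Y0*[b^t*m]) (ℤ.pos-* (b ^ Y0) _))

      r+t≡ : r ℕ.+ t ≡ σ ℕ.+ b ^ L ℕ.* b ^ J
      r+t≡ = begin
        R ℕ.+ b ^ L ℕ.* maxDigits J ℕ.+ t          ≡⟨ lemma R (b ^ L ℕ.* maxDigits J) t ⟩
        R ℕ.+ t ℕ.+ b ^ L ℕ.* maxDigits J          ≡⟨ cong (ℕ._+ b ^ L ℕ.* maxDigits J) R+t≡σ+b^L ⟩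
        σ ℕ.+ b ^ L ℕ.+ b ^ L ℕ.* maxDigits J      ≡⟨ ℕ.+-assoc σ (b ^ L) _ ⟩
        σ ℕ.+ (b ^ L ℕ.+ b ^ L ℕ.* maxDigits J)    ≡⟨ cong (σ ℕ.+_) (ℕ.*-suc (b ^ L) (maxDigits J)) ⟨
        σ ℕ.+ b ^ L ℕ.* suc (maxDigits J)          ≡⟨ cong (λ z → σ ℕ.+ b ^ L ℕ.* z) (suc-maxDigits J) ⟩
        σ ℕ.+ b ^ L ℕ.* b ^ J                      ∎
        where
        open ≡-Reasoning
        lemma : ∀ x y z → x ℕ.+ y ℕ.+ z ≡ x ℕ.+ z ℕ.+ y
        lemma = ℕ-solve-∀

      r+t<b^E : r ℕ.+ t < b ^ E
      r+t<b^E = begin-strict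
        r ℕ.+ t                          ≡⟨ r+t≡ ⟩
        σ ℕ.+ b ^ L ℕ.* b ^ J            ≡⟨ cong (σ ℕ.+_) (ℕ.^-distribˡ-+-* b L J) ⟨
        σ ℕ.+ b ^ (L ℕ.+ J)              <⟨ ℕ.+-monoˡ-< (b ^ (L ℕ.+ J)) (ℕ.<-≤-trans σ<b^L (ℕ.^-monoʳ-≤ b (ℕ.m≤m+n L J))) ⟩
        b ^ (L ℕ.+ J) ℕ.+ b ^ (L ℕ.+ J)  ≡⟨ cong (b ^ (L ℕ.+ J) ℕ.+_) (ℕ.+-identityʳ (b ^ (L ℕ.+ J))) ⟨
        2 ℕ.* b ^ (L ℕ.+ J)              ≤⟨ ℕ.*-monoˡ-≤ (b ^ (L ℕ.+ J)) 2≤b ⟩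
        b ^ E                            ∎
        where open ℕ.≤-Reasoning

      s-r : s b r ≡ s b R ℕ.+ (b ∸ 1) ℕ.* J
      s-r = trans (s-+-^* L (maxDigits J) R<b^L) (cong (s b R ℕ.+_) (s-maxDigits J))

      s-r+t : s b (r ℕ.+ t) ≡ s b (R ℕ.+ t)
      s-r+t = begin
        s b (r ℕ.+ t)                  ≡⟨ cong (s b) r+t≡ ⟩
        s b (σ ℕ.+ b ^ L ℕ.* b ^ J)    ≡⟨ s[σ+b^L*b^J] J ⟩
        s b σ ℕ.+ 1                    ≡⟨ s[σ+b^L*b^J] 0 ⟨
        s b (σ ℕ.+ b ^ L ℕ.* 1)        ≡⟨ cong (s b) (trans (cong (σ ℕ.+_) (ℕ.*-identityʳ (b ^ L))) (sym R+t≡σ+b^L)) ⟩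
        s b (R ℕ.+ t)                  ∎
        where open ≡-Reasoning

      Δs-on-residue : ∀ n → (+ n) ≡ (+ r) [mod b ^ E ] → Δs t n ≡ Δs t R - + ((b ∸ 1) ℕ.* J)
      Δs-on-residue n n≡r = a+[b+c]≡d+e⇒a-d≡e-b-c (s b (n ℕ.+ t)) (s b R) ((b ∸ 1) ℕ.* J) (s b n) (s b (R ℕ.+ t)) (begin
        s b (n ℕ.+ t) ℕ.+ (s b R ℕ.+ (b ∸ 1) ℕ.* J)  ≡⟨ cong (s b (n ℕ.+ t) ℕ.+_) s-r ⟨
        s b (n ℕ.+ t) ℕ.+ s b r                      ≡⟨ s-carry-free {E} {r} {t} {n} r+t<b^E n≡r ⟩
        s b n ℕ.+ s b (r ℕ.+ t)                      ≡⟨ cong (s b n ℕ.+_) s-r+t ⟩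
        s b n ℕ.+ s b (R ℕ.+ t)                      ∎)
        where open ≡-Reasoning

-- Two coprime bases

difference-shift : ∀ a a' b b' x X y Y d → a' - a ≡ x - X → b' - b ≡ y - Y → Y - X ≡ d - (x - y) →
                   a' - b' ≡ (a - b) + d
difference-shift a a' b b' x X y Y d a'-a b'-b Y-X = begin
  a' - b'                                   ≡⟨ lemma₁ a a' b b' ⟩
  (a - b) + ((a' - a) - (b' - b))           ≡⟨ cong₂ (λ u v → (a - b) + (u - v)) a'-a b'-b ⟩
  (a - b) + ((x - X) - (y - Y))             ≡⟨ lemma₂ (a - b) x X y Y ⟩
  (a - b) + ((x - y) + (Y - X))             ≡⟨ cong (λ w → (a - b) + ((x - y) + w)) Y-X ⟩
  (a - b) + ((x - y) + (d - (x - y)))       ≡⟨ lemma₃ (a - b) (x - y) d ⟩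
  (a - b) + d                               ∎
  where
  open ≡-Reasoning
  lemma₁ : ∀ a a' b b' → a' - b' ≡ (a - b) + ((a' - a) - (b' - b))
  lemma₁ = solve-∀
  lemma₂ : ∀ c x X y Y → c + ((x - X) - (y - Y)) ≡ c + ((x - y) + (Y - X))
  lemma₂ = solve-∀
  lemma₃ : ∀ c z d → c + (z + (d - z)) ≡ c + d
  lemma₃ = solve-∀

module TwoBases (p q : ℕ) .{{_ : NonZero p}} .{{_ : NonZero q}} (2≤p : 2 ≤ p) (2≤q : 2 ≤ q) (p⊥q : Coprime p q) where

  private
    module P = DigitSum p 2≤p
    module Q = DigitSum q 2≤q

  g : ℕ
  g = gcd (p ∸ 1) (q ∸ 1)

  δ : ℕ → ℤ
  δ x = + s p x - + s q x

  g∣p∸1 : g ℕ.∣ p ∸ 1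
  g∣p∸1 = gcd[m,n]∣m (p ∸ 1) (q ∸ 1)

  g∣q∸1 : g ℕ.∣ q ∸ 1
  g∣q∸1 = gcd[m,n]∣n (p ∸ 1) (q ∸ 1)

  g∣δ : ∀ x → + g Signed.∣ δ x
  g∣δ x = ∣a-c∧∣b-c⇒∣a-b (+ s p x) (+ s q x) (+ x) (P.∣s-n g∣p∸1 x) (Q.∣s-n g∣q∸1 x)

  g∣shift : ∀ X n d → δ X ≡ δ n + d → + g Signed.∣ d
  g∣shift X n d δX≡δn+d = subst (Signed._∣_ (+ g)) (trans (cong (_- δ n) δX≡δn+d) (lemma (δ n) d))
    (Signed.∣m∣n⇒∣m-n (g∣δ X) (g∣δ n))
    where lemma : ∀ a d → (a + d) - a ≡ d
          lemma = solve-∀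

  record Shifts (ℓ : ℕ) (d m : Fin ℓ → ℤ) (M : Fin ℓ → ℕ) (yp0 yq0 : ℕ) (a0 : ℤ) : Set where
    field
      t      : Fin ℓ → ℤ
      yp yq  : ℕ
      a      : ℤ
      yp0<yp : yp0 < yp
      yq0<yq : yq0 < yq
      t≡m    : ∀ i → t i ≡ m i [mod M i ]
      a≡a0   : a ≡ a0 [mod p ^ yp0 ℕ.* q ^ yq0 ]
      shift  : ∀ n → (+ n) ≡ a [mod p ^ yp ℕ.* q ^ yq ] → ∀ i → + 0 ℤ.≤ (+ n) + t i →
               δ ∣ (+ n) + t i ∣ ≡ δ n + d i

  single-shift : ∀ yp0 yq0 a0 d m M .{{_ : NonZero M}} → + g Signed.∣ d →
                 Shifts 1 (λ _ → d) (λ _ → m) (λ _ → M) yp0 yq0 a0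
  single-shift yp0 yq0 a0 d m M g∣d = record
    { t      = λ _ → + t
    ; yp     = WP.E
    ; yq     = WQ.E
    ; a      = a
    ; yp0<yp = WP.Y0<E
    ; yq0<yq = WQ.Y0<E
    ; t≡m    = λ _ → %ℕ+*≡[mod] m M K0
    ; a≡a0   = coprime⇒*∣ (coprime-^ yp0 yq0 p⊥q) a≡a0[p] a≡a0[q]
    ; shift  = λ n n≡a _ _ → difference-shift (+ s p n) (+ s p (n ℕ.+ t)) (+ s q n) (+ s q (n ℕ.+ t))
                 (P.Δs t SP.R) (+ ((p ∸ 1) ℕ.* J)) (Q.Δs t SQ.R) (+ ((q ∸ 1) ℕ.* J')) d
                 (WP.Δs-on-residue n (n≡r[p] n n≡a)) (WQ.Δs-on-residue n (n≡r[q] n n≡a))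
                 J'-J
    }
    where
    K0 = p ^ yp0 ℕ.* q ^ yq0
    t = m %ℕ M ℕ.+ M ℕ.* K0
    K0≤t : K0 ≤ t
    K0≤t = ℕ.≤-trans (ℕ.m≤n*m K0 M) (ℕ.m≤n+m _ (m %ℕ M))
    module SP = P.ShiftResidue yp0 a0 (ℕ.≤-trans (ℕ.m≤m*n (p ^ yp0) (q ^ yq0) {{ℕ.m^n≢0 q yq0}}) K0≤t)
    module SQ = Q.ShiftResidue yq0 a0 (ℕ.≤-trans (ℕ.m≤n*m (q ^ yq0) (p ^ yp0) {{ℕ.m^n≢0 p yp0}}) K0≤t)
    cost = P.Δs t SP.R - Q.Δs t SQ.R
    g∣d-cost : + g Signed.∣ d - cost
    g∣d-cost = Signed.∣m∣n⇒∣m-n g∣d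
      (∣a-c∧∣b-c⇒∣a-b (P.Δs t SP.R) (Q.Δs t SQ.R) (+ t) (P.∣Δs-t g∣p∸1 t SP.R) (Q.∣Δs-t g∣q∸1 t SQ.R))
    J,J' = gcd∣⇒v*J'-u*J≡ (ℕ.∸-monoˡ-≤ 1 2≤p) (ℕ.∸-monoˡ-≤ 1 2≤q) (d - cost) g∣d-cost
    J = proj₁ J,J'
    J' = proj₁ (proj₂ J,J')
    J'-J = proj₂ (proj₂ J,J')
    module WP = SP.WithMaxDigits J
    module WQ = SQ.WithMaxDigits J'
    a,a≡r = crt (coprime-^ WP.E WQ.E p⊥q) (+ WP.r) (+ WQ.r)
    a = proj₁ a,a≡r
    a≡r = proj₂ a,a≡r
    a≡a0[p] : a ≡ a0 [mod p ^ yp0 ]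
    a≡a0[p] = ≡[mod]-trans a (+ WP.r) a0 (ℕ.∣-trans (^-∣ p (ℕ.<⇒≤ WP.Y0<E)) (proj₁ a≡r)) WP.r≡a
    a≡a0[q] : a ≡ a0 [mod q ^ yq0 ]
    a≡a0[q] = ≡[mod]-trans a (+ WQ.r) a0 (ℕ.∣-trans (^-∣ q (ℕ.<⇒≤ WQ.Y0<E)) (proj₂ a≡r)) WQ.r≡a
    n≡r[p] : ∀ n → (+ n) ≡ a [mod p ^ WP.E ℕ.* q ^ WQ.E ] → (+ n) ≡ (+ WP.r) [mod p ^ WP.E ]
    n≡r[p] n n≡a = ≡[mod]-trans (+ n) a (+ WP.r) (ℕ.∣-trans (ℕ.m∣m*n (q ^ WQ.E)) n≡a) (proj₁ a≡r)
    n≡r[q] : ∀ n → (+ n) ≡ a [mod p ^ WP.E ℕ.* q ^ WQ.E ] → (+ n) ≡ (+ WQ.r) [mod q ^ WQ.E ]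
    n≡r[q] n n≡a = ≡[mod]-trans (+ n) a (+ WQ.r) (ℕ.∣-trans (ℕ.n∣m*n (p ^ WP.E)) n≡a) (proj₂ a≡r)

  p^q^-∣ : ∀ {i j k l} → i ≤ k → j ≤ l → p ^ i ℕ.* q ^ j ℕ.∣ p ^ k ℕ.* q ^ l
  p^q^-∣ i≤k j≤l = ℕ.*-pres-∣ (^-∣ p i≤k) (^-∣ q j≤l)

  _∷ˢ_ : ∀ {ℓ d m M yp0 yq0 a0} (S : Shifts 1 (λ _ → d zero) (λ _ → m zero) (λ _ → M zero) yp0 yq0 a0) →
         Shifts ℓ (d ∘ suc) (m ∘ suc) (M ∘ suc) (Shifts.yp S) (Shifts.yq S) (Shifts.a S) →
         Shifts (suc ℓ) d m M yp0 yq0 a0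
  _∷ˢ_ {yp0 = yp0} {yq0} {a0} S T = record
    { t      = λ { zero → S.t zero ; (suc i) → T.t i }
    ; yp     = T.yp
    ; yq     = T.yq
    ; a      = T.a
    ; yp0<yp = ℕ.<-trans S.yp0<yp T.yp0<yp
    ; yq0<yq = ℕ.<-trans S.yq0<yq T.yq0<yq
    ; t≡m    = λ { zero → S.t≡m zero ; (suc i) → T.t≡m i }
    ; a≡a0   = a≡a0
    ; shift  = λ { n n≡a zero → S.shift n (n≡Sa n n≡a) zero ; n n≡a (suc i) → T.shift n n≡a i }
    }
    where
    module S = Shifts S
    module T = Shifts T
    a≡a0 : T.a ≡ a0 [mod p ^ yp0 ℕ.* q ^ yq0 ]
    a≡a0 = ≡[mod]-trans T.a S.a a0 (ℕ.∣-trans (p^q^-∣ (ℕ.<⇒≤ S.yp0<yp) (ℕ.<⇒≤ S.yq0<yq)) T.a≡a0) S.a≡a0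
    n≡Sa : ∀ n → (+ n) ≡ T.a [mod p ^ T.yp ℕ.* q ^ T.yq ] → (+ n) ≡ S.a [mod p ^ S.yp ℕ.* q ^ S.yq ]
    n≡Sa n n≡a = ≡[mod]-trans (+ n) T.a S.a (ℕ.∣-trans (p^q^-∣ (ℕ.<⇒≤ T.yp0<yp) (ℕ.<⇒≤ T.yq0<yq)) n≡a) T.a≡a0

  shifts : ∀ ℓ (d m : Fin ℓ → ℤ) (M : Fin ℓ → ℕ) → (∀ i → 1 ≤ M i) → (∀ i → + g Signed.∣ d i) →
           ∀ yp0 yq0 a0 → Shifts ℓ d m M yp0 yq0 a0
  shifts zero    d m M _   _   yp0 yq0 a0 = record
    { t = λ () ; yp = suc yp0 ; yq = suc yq0 ; a = a0 ; yp0<yp = ℕ.≤-refl ; yq0<yq = ℕ.≤-refl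
    ; t≡m = λ () ; a≡a0 = ≡[mod]-refl a0 ; shift = λ _ _ () }
  shifts (suc ℓ) d m M 1≤M g∣d yp0 yq0 a0 =
    _∷ˢ_ {d = d} {m} {M} S₀
      (shifts ℓ (d ∘ suc) (m ∘ suc) (M ∘ suc) (1≤M ∘ suc) (g∣d ∘ suc) (Shifts.yp S₀) (Shifts.yq S₀) (Shifts.a S₀))
    where S₀ = single-shift yp0 yq0 a0 (d zero) (m zero) (M zero) {{ℕ.>-nonZero (1≤M zero)}} (g∣d zero)

proposition4p2 : (p q : ℕ) → .{{_ : NonZero p}} → .{{_ : NonZero q}} → 2 ≤ p → p < q → Coprime p q →
    (yp0 yq0 a0 : ℕ) → a0 < p ^ yp0 ℕ.* q ^ yq0 →
    (ℓ : ℕ) → 1 ≤ ℓ → (d m : Fin ℓ → ℤ) → (M : Fin ℓ → ℕ) → (∀ i → 1 ≤ M i) →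
    ((∀ i → (+ gcd (p ∸ 1) (q ∸ 1)) ∣ d i)
      ⇔
     (Σ (Fin ℓ → ℤ) λ t → Σ ℕ λ yp → Σ ℕ λ yq → Σ ℤ λ a →
        yp0 < yp × yq0 < yq ×
        (∀ i → t i ≡ m i [mod M i ]) ×
        (a ≡ + a0 [mod p ^ yp0 ℕ.* q ^ yq0 ]) ×
        (∀ (n : ℕ) → (+ n) ≡ a [mod p ^ yp ℕ.* q ^ yq ] → ∀ i → + 0 ℤ.≤ (+ n) + t i →
           (+ (s p ∣ (+ n) + t i ∣)) - (+ (s q ∣ (+ n) + t i ∣))
             ≡ ((+ s p n) - (+ s q n)) + d i)))
proposition4p2 p q 2≤p p<q p⊥q yp0 yq0 a0 _ ℓ _ d m M 1≤M = mk⇔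
  (λ g∣d → let open Shifts (shifts ℓ d m M 1≤M (∣ᵤ⇒∣ ∘ g∣d) yp0 yq0 (+ a0))
           in t , yp , yq , a , yp0<yp , yq0<yq , t≡m , a≡a0 , shift)
  (λ (t , yp , yq , a , _ , _ , _ , _ , shift) i →
     let instance K≢0 = ℕ.m*n≢0 (p ^ yp) (q ^ yq) {{ℕ.m^n≢0 p yp}} {{ℕ.m^n≢0 q yq}}
         K = p ^ yp ℕ.* q ^ yq
         n = a %ℕ K ℕ.+ K ℕ.* ∣ t i ∣
     in ∣⇒∣ᵤ (g∣shift ∣ + n + t i ∣ n (d i)
          (shift n (%ℕ+*≡[mod] a K ∣ t i ∣) i
            (∣i∣≤n⇒0≤n+i (t i) (ℕ.≤-trans (ℕ.m≤n*m ∣ t i ∣ K) (ℕ.m≤n+m _ (a %ℕ K)))))))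
  where open TwoBases p q 2≤p (ℕ.≤-trans 2≤p (ℕ.<⇒≤ p<q)) p⊥q
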